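{- Let $n\ge 1$ and $\omega\in S_n$. The poset $M_\omega$ (ordered by the product order on $\mathbb{N}^n$) is $B_2$-free if and only if $\omega$ avoids both the pattern $3412$ and the pattern $3421$.
   Context: Permutations are written in one-line notation $\omega=\omega(1)\cdots\omega(n)$. ${\rm Inv}(\omega)=\{(i,j): 1\le i<j\le n,\ \omega(i)>\omega(j)\}$. For $1\le i\le n$ let $c_i(\omega)=\#\{j: i<j\le n,\ \omega(i)>\omega(j)\}$, and for $1\le i<j\le n$ let $c_{i,j}(\omega)=\#\{k: i<k<j,\ \omega(i)>\omega(k)\}$. For $[m]=\{1,\dots,m\}$. For each $i$ with $c_i(\omega)>0$ and each $x\in[c_i(\omega)]$, define $m_{i,x}(\omega)\in\mathbb{N}^n$ by its $j$-th coordinate $\pi_j$: $\pi_j=0$ if $(i,j)\in{\rm Inv}(\omega)$; $\pi_j=0$ if $j<i$; $\pi_j=x$ if $j=i$; $\pi_j=\max\{0,x-c_{i,j}(\omega)\}$ if $j>i$ and $(i,j)\notin{\rm Inv}(\omega)$. Let $M_\omega=\{m_{i,x}(\omega): 1\le i\le n,\ c_i(\omega)>0,\ x\in[c_i(\omega)]\}$, a poset under the componentwise (product) order on $\mathbb{N}^n$. $B_2$ denotes the Boolean lattice of rank 2 (four elements $a<b<d$, $a<c<d$, with $b,c$ incomparable). A poset $P$ is $B_2$-free if there is no set of four distinct elements of $P$ which, with the induced order, is isomorphic to $B_2$. For $\pi\in S_k$, $k<n$, $\omega$ avoids $\pi$ if there are no indices $i_1<\dots<i_k$ such that $\omega(i_1)\cdots\omega(i_k)$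 is order-isomorphic to $\pi(1)\cdots\pi(k)$ (i.e. its standardization equals $\pi$). -}

module Defs where

open import Data.Nat using (ℕ; zero; suc; _+_; _∸_; _≤_; _<_; _<ᵇ_)
open import Data.Bool using (Bool; true; false; if_then_else_; _∧_)
open import Data.Fin using (Fin; toℕ)
open import Data.Fin.Permutation using (Permutation′; _⟨$⟩ʳ_)
open import Data.List using (List; length; filter)
open import Data.List.Base using (allFin)
open import Data.Product using (Σ; _×_; ∃; ∃-syntax)
open import Data.Empty using (⊥)
open import Relation.Nullary using (¬_)
open import Relation.Binary.PropositionalEquality using (_≡_)
open import Data.Bool.Properties using (T?)
open import Function.Bundles using (_⇔_)
open import Data.Bool using (T)

-- A permutation ω ∈ S_n; its value at position i (both positions and values in Fin n,
-- i.e. 0-based; only the relative order of values matters).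
val : ∀ {n} → Permutation′ n → Fin n → ℕ
val ω i = toℕ (ω ⟨$⟩ʳ i)

count : ∀ {n} → (Fin n → Bool) → ℕ
count {n} p = length (filter (λ j → T? (p j)) (allFin n))

c : ∀ {n} → Permutation′ n → Fin n → ℕ
c ω i = count (λ j → (toℕ i <ᵇ toℕ j) ∧ (val ω j <ᵇ val ω i))

c₂ : ∀ {n} → Permutation′ n → Fin n → Fin n → ℕ
c₂ ω i j = count (λ k → (toℕ i <ᵇ toℕ k) ∧ (toℕ k <ᵇ toℕ j) ∧ (val ω k <ᵇ val ω i))

isInv : ∀ {n} → Permutation′ n → Fin n → Fin n → Bool
isInv ω i j = (toℕ i <ᵇ toℕ j) ∧ (val ω j <ᵇ val ω i)

-- the vector m_{i,x}(ω) ∈ ℕ^n, as a function Fin n → ℕ  (max{0, x - c} = x ∸ c)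
mvec : ∀ {n} → Permutation′ n → Fin n → ℕ → Fin n → ℕ
mvec ω i x j =
  if toℕ j <ᵇ toℕ i then 0
  else if toℕ i <ᵇ toℕ j
       then (if isInv ω i j then 0 else x ∸ c₂ ω i j)
       else x

_≐_ : ∀ {n} → (Fin n → ℕ) → (Fin n → ℕ) → Set
u ≐ v = ∀ j → u j ≡ v j

_≼_ : ∀ {n} → (Fin n → ℕ) → (Fin n → ℕ) → Set
u ≼ v = ∀ j → u j ≤ v j

InM : ∀ {n} → Permutation′ n → (Fin n → ℕ) → Set
InM ω v = ∃[ i ] ∃[ x ] (1 ≤ x × x ≤ c ω i × v ≐ mvec ω i x)

-- four distinct elements a,b,c,d of M_ω whose induced order is B₂:
-- a < b < d, a < c < d, b and c incomparable
-- (a ≤ d follows by transitivity of the product order).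
HasB₂ : ∀ {n} → Permutation′ n → Set
HasB₂ {n} ω =
  Σ (Fin n → ℕ) λ a → Σ (Fin n → ℕ) λ b → Σ (Fin n → ℕ) λ e → Σ (Fin n → ℕ) λ d →
    InM ω a × InM ω b × InM ω e × InM ω d ×
    ¬ (a ≐ b) × ¬ (a ≐ e) × ¬ (a ≐ d) × ¬ (b ≐ e) × ¬ (b ≐ d) × ¬ (e ≐ d) ×
    a ≼ b × a ≼ e × b ≼ d × e ≼ d × ¬ (b ≼ e) × ¬ (e ≼ b)

B₂-free : ∀ {n} → Permutation′ n → Set
B₂-free ω = ¬ HasB₂ ω

-- ω contains the pattern p (given in one-line notation p(1)…p(k) as a function Fin k → ℕ):
-- strictly increasing positions f with ω(f a) < ω(f b) ⇔ p a < p b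
Contains : ∀ {n k} → Permutation′ n → (Fin k → ℕ) → Set
Contains {n} {k} ω p =
  Σ (Fin k → Fin n) λ f →
    (∀ a b → toℕ a < toℕ b → toℕ (f a) < toℕ (f b)) ×
    (∀ a b → (val ω (f a) < val ω (f b)) ⇔ (p a < p b))

Avoids : ∀ {n k} → Permutation′ n → (Fin k → ℕ) → Set
Avoids ω p = ¬ Contains ω p

pat3412 : Fin 4 → ℕ
pat3412 Fin.zero = 3
pat3412 (Fin.suc Fin.zero) = 4
pat3412 (Fin.suc (Fin.suc Fin.zero)) = 1
pat3412 (Fin.suc (Fin.suc (Fin.suc Fin.zero))) = 2

pat3421 : Fin 4 → ℕ
pat3421 Fin.zero = 3
pat3421 (Fin.suc Fin.zero) = 4
pat3421 (Fin.suc (Fin.suc Fin.zero)) = 2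
pat3421 (Fin.suc (Fin.suc (Fin.suc Fin.zero))) = 1

module Submission where

-- For x ≥ 1 the vector m_{q,x} lies below m_{p,y} exactly when either p = q and x ≤ y, or
-- p < q, ω(p) < ω(q) and x + c_{p,q} ≤ y.  When p < s and ω(p) < ω(s) one has
-- c_p = c_{p,s} + #{j > s : ω(j) < ω(p)}, so if m_{s,w} ≤ m_{p,y} with p ≠ s, w ≥ 2 and y ≤ c_p,
-- there are two positions j > s with ω(j) < ω(p) < ω(s): an occurrence of 3412 or 3421.
-- In a B₂ whose middle elements lie in rows r < s, one of them is such an element below the top,
-- for otherwise the two middle elements would be comparable.  Conversely an occurrence at
-- p < r < j < k yields the B₂  m_{r,1} < m_{p,1+c_{p,r}}, m_{r,2} < m_{p,2+c_{p,r}}.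

open import Defs
open import Data.Bool using (Bool; true; false; if_then_else_; T; _∧_)
open import Data.Bool.Properties using (T?; T-∧; T-≡)
open import Data.Empty using (⊥-elim)
open import Data.Fin using (Fin; toℕ; zero; suc; #_)
open import Data.Fin.Permutation using (Permutation′)
open import Data.Fin.Properties using (toℕ-injective)
open import Data.List using (length; filter; tabulate)
open import Data.Nat
  using (ℕ; zero; suc; _+_; _∸_; _≤_; _<_; _<ᵇ_; z≤n; s≤s; z<s; s<s; s≤s⁻¹; s<s⁻¹)
open import Data.Nat.Properties
open import Data.Product using (_×_; _,_; proj₁; proj₂; ∃-syntax)
open import Data.Sum using (_⊎_; inj₁; inj₂; [_,_])
open import Data.Unit using (⊤; tt)
open import Data.Vec using (_∷_; []; lookup)
open import Function using (_∘_)
open import Function.Bundles using (_⇔_; mk⇔; Equivalence; Injection)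
open import Function.Properties.Inverse using (Inverse⇒Injection)
open import Relation.Binary using (tri<; tri≈; tri>)
open import Relation.Binary.PropositionalEquality using (_≡_; refl; sym; trans; cong; subst; subst₂)
open import Relation.Nullary using (¬_; yes; no)
open import Relation.Unary using (_⊆′_; _∪_; _⊥′_)

count-tabulate : ∀ {A : Set} {n} (p : A → Bool) (f : Fin n → A) →
  length (filter (λ j → T? (p j)) (tabulate f)) ≡ count (p ∘ f)
count-tabulate {n = zero} p f = refl
count-tabulate {n = suc n} p f with p (f zero)
... | true  = cong suc (trans (count-tabulate p (f ∘ suc)) (sym (count-tabulate (p ∘ f) suc)))
... | false = trans (count-tabulate p (f ∘ suc)) (sym (count-tabulate (p ∘ f) suc))

count-suc : ∀ {n} (p : Fin (suc n) → Bool) →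
  count p ≡ (if p zero then suc (count (p ∘ suc)) else count (p ∘ suc))
count-suc p with p zero
... | true  = cong suc (count-tabulate p suc)
... | false = count-tabulate p suc

T-true : ∀ {b} → b ≡ true → T b
T-true refl = tt

count-mono : ∀ {n} {p q : Fin n → Bool} → T ∘ p ⊆′ T ∘ q → count p ≤ count q
count-mono {zero} p⊆q = z≤n
count-mono {suc n} {p} {q} p⊆q
  rewrite count-suc p | count-suc q
  with p zero in e | q zero in f | count-mono {p = p ∘ suc} {q ∘ suc} (p⊆q ∘ suc)
... | true  | true  | ih = s≤s ih
... | true  | false | ih = ⊥-elim (subst T f (p⊆q zero (T-true e)))
... | false | true  | ih = m≤n⇒m≤1+n ih
... | false | false | ih = ih

≤-if-suc : ∀ b a → a ≤ (if b then suc a else a)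
≤-if-suc true  a = n≤1+n a
≤-if-suc false a = ≤-refl

count-subadditive : ∀ {n} {p q r : Fin n → Bool} → T ∘ p ⊆′ T ∘ q ∪ T ∘ r →
  count p ≤ count q + count r
count-subadditive {zero} p⊆q∪r = z≤n
count-subadditive {suc n} {p} {q} {r} p⊆q∪r
  rewrite count-suc p | count-suc q | count-suc r
  with p zero in e | q zero in f | r zero in g
     | count-subadditive {p = p ∘ suc} {q ∘ suc} {r ∘ suc} (p⊆q∪r ∘ suc)
... | false | b     | b′    | ih = ≤-trans ih (+-mono-≤ (≤-if-suc b _) (≤-if-suc b′ _))
... | true  | true  | b′    | ih = s≤s (≤-trans ih (+-monoʳ-≤ _ (≤-if-suc b′ _)))
... | true  | false | true  | ih = ≤-trans (s≤s ih) (≤-reflexive (sym (+-suc _ _)))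
... | true  | false | false | ih with p⊆q∪r zero (T-true e)
...   | inj₁ t = ⊥-elim (subst T f t)
...   | inj₂ t = ⊥-elim (subst T g t)

count-disjoint : ∀ {n} {p q r : Fin n → Bool} → T ∘ q ⊆′ T ∘ p → T ∘ r ⊆′ T ∘ p → T ∘ q ⊥′ T ∘ r →
  count q + count r ≤ count p
count-disjoint {zero} q⊆p r⊆p q⊥r = z≤n
count-disjoint {suc n} {p} {q} {r} q⊆p r⊆p q⊥r
  rewrite count-suc p | count-suc q | count-suc r
  with p zero in e | q zero in f | r zero in g
     | count-disjoint {p = p ∘ suc} {q ∘ suc} {r ∘ suc} (q⊆p ∘ suc) (r⊆p ∘ suc) (q⊥r ∘ suc)
... | _     | true  | true  | ih = ⊥-elim (q⊥r zero (T-true f , T-true g))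
... | false | true  | _     | ih = ⊥-elim (subst T e (q⊆p zero (T-true f)))
... | false | _     | true  | ih = ⊥-elim (subst T e (r⊆p zero (T-true g)))
... | true  | true  | false | ih = s≤s ih
... | true  | false | true  | ih = ≤-trans (≤-reflexive (+-suc _ _)) (s≤s ih)
... | true  | false | false | ih = m≤n⇒m≤1+n ih
... | false | false | false | ih = ih

count-pos⇒witness : ∀ {n} {p : Fin n → Bool} → 1 ≤ count p → ∃[ j ] T (p j)
count-pos⇒witness {suc n} {p} pos rewrite count-suc p with p zero in e
... | true  = zero , T-true e
... | false with count-pos⇒witness {p = p ∘ suc} pos
...   | j , t = suc j , t

count≥2⇒two-witnesses : ∀ {n} {p : Fin n → Bool} → 2 ≤ count p →
  ∃[ j ] ∃[ k ] (toℕ j < toℕ k × T (p j) × T (p k))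
count≥2⇒two-witnesses {suc n} {p} two rewrite count-suc p with p zero in e
... | true with count-pos⇒witness {p = p ∘ suc} (s≤s⁻¹ two)
...   | k , t = zero , suc k , z<s , T-true e , t
count≥2⇒two-witnesses {suc n} {p} two | false with count≥2⇒two-witnesses {p = p ∘ suc} two
...   | j , k , j<k , tj , tk = suc j , suc k , s<s j<k , tj , tk

witness⇒count-pos : ∀ {n} {p : Fin n → Bool} {j} → T (p j) → 1 ≤ count p
witness⇒count-pos {suc n} {p} {zero} t rewrite count-suc p with p zero | t
... | true | _ = s≤s z≤n
witness⇒count-pos {suc n} {p} {suc j} t rewrite count-suc p =
  ≤-trans (witness⇒count-pos {p = p ∘ suc} t) (≤-if-suc (p zero) _)

two-witnesses⇒count≥2 : ∀ {n} {p : Fin n → Bool} {j k} → toℕ j < toℕ k → T (p j) → T (p k) →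
  2 ≤ count p
two-witnesses⇒count≥2 {suc n} {p} {zero} {suc k} _ tj tk rewrite count-suc p with p zero | tj
... | true | _ = s≤s (witness⇒count-pos {p = p ∘ suc} tk)
two-witnesses⇒count≥2 {suc n} {p} {suc j} {suc k} j<k tj tk rewrite count-suc p =
  ≤-trans (two-witnesses⇒count≥2 {p = p ∘ suc} (s<s⁻¹ j<k) tj tk) (≤-if-suc (p zero) _)

Ascending : ∀ {k} → (Fin k → ℕ) → Set
Ascending {zero}        g = ⊤
Ascending {suc zero}    g = ⊤
Ascending {suc (suc k)} g = g zero < g (suc zero) × Ascending (g ∘ suc)

ascending⇒strictlyIncreasing : ∀ {k} {g : Fin k → ℕ} → Ascending g →
  ∀ {a b} → toℕ a < toℕ b → g a < g b
ascending⇒strictlyIncreasing {suc zero} _ {zero} {zero} ()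
ascending⇒strictlyIncreasing {suc (suc k)} (g₀<g₁ , _) {zero} {suc zero} _ = g₀<g₁
ascending⇒strictlyIncreasing {suc (suc k)} (g₀<g₁ , asc) {zero} {suc (suc b)} _ =
  <-trans g₀<g₁ (ascending⇒strictlyIncreasing asc {zero} {suc b} z<s)
ascending⇒strictlyIncreasing {suc (suc k)} (_ , asc) {suc a} {suc b} a<b =
  ascending⇒strictlyIncreasing asc (s<s⁻¹ a<b)

<ᵇ-true : ∀ {m n} → m < n → (m <ᵇ n) ≡ true
<ᵇ-true m<n = Equivalence.to T-≡ (<⇒<ᵇ m<n)

<ᵇ-false : ∀ {m n} → n ≤ m → (m <ᵇ n) ≡ false
<ᵇ-false {m} {n} n≤m with m <ᵇ n in e
... | true  = ⊥-elim (<⇒≱ (<ᵇ⇒< m n (T-true e)) n≤m)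
... | false = refl

0<m≤o∸n⇒m+n≤o : ∀ {m n o} → 0 < m → m ≤ o ∸ n → m + n ≤ o
0<m≤o∸n⇒m+n≤o {m} {n} {o} 0<m m≤o∸n = m≤o∸n⇒m+n≤o m (<⇒≤ n<o) m≤o∸n
  where
  n<o : n < o
  n<o = m∸n≢0⇒n<m λ o∸n≡0 → <⇒≱ 0<m (subst (m ≤_) o∸n≡0 m≤o∸n)

Fin4-elim : {P : Fin 4 → Set} → P (# 0) → P (# 1) → P (# 2) → P (# 3) → ∀ a → P a
Fin4-elim p₀ p₁ p₂ p₃ zero                   = p₀
Fin4-elim p₀ p₁ p₂ p₃ (suc zero)             = p₁
Fin4-elim p₀ p₁ p₂ p₃ (suc (suc zero))       = p₂
Fin4-elim p₀ p₁ p₂ p₃ (suc (suc (suc zero))) = p₃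

record Ranking {k} (pat : Fin k → ℕ) : Set where
  field
    rank unrank : Fin k → Fin k
    pat≡1+rank  : ∀ a → pat a ≡ suc (toℕ (rank a))
    unrank∘rank : ∀ a → unrank (rank a) ≡ a

rank-order : ∀ {k} {pat : Fin k → ℕ} (R : Ranking pat) (g : Fin k → ℕ) →
  (∀ {a b} → toℕ a < toℕ b → g (Ranking.unrank R a) < g (Ranking.unrank R b)) →
  ∀ a b → g a < g b ⇔ pat a < pat b
rank-order {pat = pat} R g mono a b = mk⇔ reflect preserve
  where
  open Ranking R
  preserve : ∀ {a b} → pat a < pat b → g a < g b
  preserve {a} {b} lt = subst₂ (λ a′ b′ → g a′ < g b′) (unrank∘rank a) (unrank∘rank b)
    (mono (s<s⁻¹ (subst₂ _<_ (pat≡1+rank a) (pat≡1+rank b) lt)))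
  reflect : g a < g b → pat a < pat b
  reflect lt with <-cmp (pat a) (pat b)
  ... | tri< pa<pb _ _ = pa<pb
  ... | tri> _ _ pb<pa = ⊥-elim (<-asym lt (preserve pb<pa))
  ... | tri≈ _ pa≡pb _ = ⊥-elim (<-irrefl (cong g a≡b) lt)
    where
    rank≡ : rank a ≡ rank b
    rank≡ = toℕ-injective (suc-injective
      (trans (sym (pat≡1+rank a)) (trans pa≡pb (pat≡1+rank b))))
    a≡b : a ≡ b
    a≡b = trans (sym (unrank∘rank a)) (trans (cong unrank rank≡) (unrank∘rank b))

ranking3412 : Ranking pat3412
ranking3412 = record
  { rank        = lookup (# 2 ∷ # 3 ∷ # 0 ∷ # 1 ∷ [])
  ; unrank      = lookup (# 2 ∷ # 3 ∷ # 0 ∷ # 1 ∷ [])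
  ; pat≡1+rank  = Fin4-elim refl refl refl refl
  ; unrank∘rank = Fin4-elim refl refl refl refl
  }

ranking3421 : Ranking pat3421
ranking3421 = record
  { rank        = lookup (# 2 ∷ # 3 ∷ # 1 ∷ # 0 ∷ [])
  ; unrank      = lookup (# 3 ∷ # 2 ∷ # 0 ∷ # 1 ∷ [])
  ; pat≡1+rank  = Fin4-elim refl refl refl refl
  ; unrank∘rank = Fin4-elim refl refl refl refl
  }

module _ {n : ℕ} where

  ≐-sym : {u v : Fin n → ℕ} → u ≐ v → v ≐ u
  ≐-sym u≐v j = sym (u≐v j)

  ≐⇒≼ : {u v : Fin n → ℕ} → u ≐ v → u ≼ v
  ≐⇒≼ u≐v j = ≤-reflexive (u≐v j)

  ≼-trans : {u v w : Fin n → ℕ} → u ≼ v → v ≼ w → u ≼ w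
  ≼-trans u≼v v≼w j = ≤-trans (u≼v j) (v≼w j)

  ≼-resp-≐ : {u u′ v v′ : Fin n → ℕ} → u ≐ u′ → v ≐ v′ → u ≼ v → u′ ≼ v′
  ≼-resp-≐ u≐u′ v≐v′ u≼v = ≼-trans (≐⇒≼ (≐-sym u≐u′)) (≼-trans u≼v (≐⇒≼ v≐v′))

module _ {n : ℕ} (ω : Permutation′ n) where

  val-injective : ∀ {i j} → val ω i ≡ val ω j → i ≡ j
  val-injective e = Injection.injective (Inverse⇒Injection ω) (toℕ-injective e)

  -- c ω p is definitionally #below-after p p, and c₂ ω p q is count (below-between p q).
  below-after : Fin n → Fin n → Fin n → Bool
  below-after s p j = (toℕ s <ᵇ toℕ j) ∧ (val ω j <ᵇ val ω p)

  #below-after : Fin n → Fin n → ℕ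
  #below-after s p = count (below-after s p)

  below-between : Fin n → Fin n → Fin n → Bool
  below-between p q k = (toℕ p <ᵇ toℕ k) ∧ (toℕ k <ᵇ toℕ q) ∧ (val ω k <ᵇ val ω p)

  below-after⁺ : ∀ {s p j} → toℕ s < toℕ j → val ω j < val ω p → T (below-after s p j)
  below-after⁺ s<j vj<vp = Equivalence.from T-∧ (<⇒<ᵇ s<j , <⇒<ᵇ vj<vp)

  below-after⁻ : ∀ {s p j} → T (below-after s p j) → toℕ s < toℕ j × val ω j < val ω p
  below-after⁻ {s} {p} {j} t with Equivalence.to T-∧ t
  ... | t₁ , t₂ = <ᵇ⇒< (toℕ s) (toℕ j) t₁ , <ᵇ⇒< (val ω j) (val ω p) t₂

  below-between⁺ : ∀ {p q k} → toℕ p < toℕ k → toℕ k < toℕ q → val ω k < val ω p →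
    T (below-between p q k)
  below-between⁺ p<k k<q vk<vp =
    Equivalence.from T-∧ (<⇒<ᵇ p<k , Equivalence.from T-∧ (<⇒<ᵇ k<q , <⇒<ᵇ vk<vp))

  below-between⁻ : ∀ {p q k} → T (below-between p q k) →
    toℕ p < toℕ k × toℕ k < toℕ q × val ω k < val ω p
  below-between⁻ {p} {q} {k} t with Equivalence.to T-∧ t
  ... | t₁ , t₂ with Equivalence.to T-∧ t₂
  ...   | t₃ , t₄ = <ᵇ⇒< (toℕ p) (toℕ k) t₁ , <ᵇ⇒< (toℕ k) (toℕ q) t₃ , <ᵇ⇒< (val ω k) (val ω p) t₄

  c₂-triangle : ∀ {p q} j → toℕ p < toℕ q → val ω p < val ω q →
    c₂ ω p j ≤ c₂ ω p q + c₂ ω q j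
  c₂-triangle {p} {q} j p<q vp<vq = count-subadditive split
    where
    split : T ∘ below-between p j ⊆′ T ∘ below-between p q ∪ T ∘ below-between q j
    split k t with below-between⁻ {p} {j} {k} t
    ... | p<k , k<j , vk<vp with <-cmp (toℕ k) (toℕ q)
    ... | tri< k<q _ _ = inj₁ (below-between⁺ p<k k<q vk<vp)
    ... | tri≈ _ k≡q _ =
      ⊥-elim (<-asym vp<vq (subst (λ z → val ω z < val ω p) (toℕ-injective k≡q) vk<vp))
    ... | tri> _ _ q<k = inj₂ (below-between⁺ q<k k<j (<-trans vk<vp vp<vq))

  c₂-monoʳ-≤ : ∀ p {s q} → toℕ s ≤ toℕ q → c₂ ω p s ≤ c₂ ω p q
  c₂-monoʳ-≤ p {s} {q} s≤q = count-mono widen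
    where
    widen : T ∘ below-between p s ⊆′ T ∘ below-between p q
    widen k t with below-between⁻ {p} {s} {k} t
    ... | p<k , k<s , vk<vp = below-between⁺ p<k (<-≤-trans k<s s≤q) vk<vp

  c≡c₂+#below-after : ∀ {p s} → toℕ p < toℕ s → val ω p < val ω s →
    c ω p ≡ c₂ ω p s + #below-after s p
  c≡c₂+#below-after {p} {s} p<s vp<vs =
    ≤-antisym (count-subadditive split)
              (count-disjoint between⊆ after⊆ disjoint)
    where
    split : T ∘ below-after p p ⊆′ T ∘ below-between p s ∪ T ∘ below-after s p
    split k t with below-after⁻ {p} {p} {k} t
    ... | p<k , vk<vp with <-cmp (toℕ k) (toℕ s)
    ... | tri< k<s _ _ = inj₁ (below-between⁺ p<k k<s vk<vp)
    ... | tri≈ _ k≡s _ =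
      ⊥-elim (<-asym vp<vs (subst (λ z → val ω z < val ω p) (toℕ-injective k≡s) vk<vp))
    ... | tri> _ _ s<k = inj₂ (below-after⁺ s<k vk<vp)
    between⊆ : T ∘ below-between p s ⊆′ T ∘ below-after p p
    between⊆ k t with below-between⁻ {p} {s} {k} t
    ... | p<k , _ , vk<vp = below-after⁺ p<k vk<vp
    after⊆ : T ∘ below-after s p ⊆′ T ∘ below-after p p
    after⊆ k t with below-after⁻ {s} {p} {k} t
    ... | s<k , vk<vp = below-after⁺ (<-trans p<s s<k) vk<vp
    disjoint : T ∘ below-between p s ⊥′ T ∘ below-after s p
    disjoint k (t₁ , t₂) =
      <-asym (proj₁ (proj₂ (below-between⁻ {p} {s} {k} t₁))) (proj₁ (below-after⁻ {s} {p} {k} t₂))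

  data Position (i : Fin n) : Fin n → Set where
    before   : ∀ {j} → toℕ j < toℕ i → Position i j
    at       : Position i i
    inverted : ∀ {j} → toℕ i < toℕ j → val ω j < val ω i → Position i j
    ascent   : ∀ {j} → toℕ i < toℕ j → val ω i < val ω j → Position i j

  position : ∀ i j → Position i j
  position i j with <-cmp (toℕ j) (toℕ i)
  ... | tri< j<i _ _ = before j<i
  ... | tri≈ _ j≡i _ with toℕ-injective j≡i
  ...   | refl = at
  position i j | tri> _ _ i<j with <-cmp (val ω j) (val ω i)
  ...   | tri< vj<vi _ _ = inverted i<j vj<vi
  ...   | tri≈ _ vj≡vi _ = ⊥-elim (<-irrefl (cong toℕ (sym (val-injective vj≡vi))) i<j)
  ...   | tri> _ _ vi<vj = ascent i<j vi<vj

  mvec-before : ∀ {i j} x → toℕ j < toℕ i → mvec ω i x j ≡ 0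
  mvec-before x j<i rewrite <ᵇ-true j<i = refl

  mvec-at : ∀ i x → mvec ω i x i ≡ x
  mvec-at i x rewrite <ᵇ-false (≤-refl {toℕ i}) = refl

  mvec-inverted : ∀ {i j} x → toℕ i < toℕ j → val ω j < val ω i → mvec ω i x j ≡ 0
  mvec-inverted x i<j vj<vi rewrite <ᵇ-false (<⇒≤ i<j) | <ᵇ-true i<j | <ᵇ-true vj<vi = refl

  mvec-ascent : ∀ {i j} x → toℕ i < toℕ j → val ω i < val ω j → mvec ω i x j ≡ x ∸ c₂ ω i j
  mvec-ascent x i<j vi<vj rewrite <ᵇ-false (<⇒≤ i<j) | <ᵇ-true i<j | <ᵇ-false (<⇒≤ vi<vj) = refl

  Label : Set
  Label = Fin n × ℕ

  m : Label → Fin n → ℕ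
  m (i , x) = mvec ω i x

  infix 4 _⊑_

  data _⊑_ : Label → Label → Set where
    same-row    : ∀ {i x y} → x ≤ y → (i , x) ⊑ (i , y)
    earlier-row : ∀ {p q x y} → toℕ p < toℕ q → val ω p < val ω q → x + c₂ ω p q ≤ y →
                  (q , x) ⊑ (p , y)

  ⊑-position : ∀ {q x p y} → (q , x) ⊑ (p , y) → toℕ p ≤ toℕ q
  ⊑-position (same-row _)          = ≤-refl
  ⊑-position (earlier-row p<q _ _) = <⇒≤ p<q

  ⊑⇒≼ : ∀ {a b} → a ⊑ b → m a ≼ m b
  ⊑⇒≼ {i , x} {_ , y} (same-row x≤y) j with position i j
  ... | before j<i rewrite mvec-before x j<i = z≤n
  ... | at rewrite mvec-at i x | mvec-at i y = x≤y
  ... | inverted i<j vj<vi rewrite mvec-inverted x i<j vj<vi = z≤n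
  ... | ascent i<j vi<vj rewrite mvec-ascent x i<j vi<vj | mvec-ascent y i<j vi<vj =
    ∸-monoˡ-≤ (c₂ ω i j) x≤y
  ⊑⇒≼ {q , x} {p , y} (earlier-row p<q vp<vq x+c≤y) j with position q j
  ... | before j<q rewrite mvec-before x j<q = z≤n
  ... | at rewrite mvec-at q x | mvec-ascent y p<q vp<vq = m+n≤o⇒m≤o∸n x x+c≤y
  ... | inverted q<j vj<vq rewrite mvec-inverted x q<j vj<vq = z≤n
  ... | ascent q<j vq<vj
    rewrite mvec-ascent x q<j vq<vj | mvec-ascent y (<-trans p<q q<j) (<-trans vp<vq vq<vj) = begin
      x ∸ c₂ ω q j                   ≤⟨ ∸-monoˡ-≤ (c₂ ω q j) (m+n≤o⇒m≤o∸n x x+c≤y) ⟩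
      y ∸ c₂ ω p q ∸ c₂ ω q j        ≡⟨ ∸-+-assoc y (c₂ ω p q) (c₂ ω q j) ⟩
      y ∸ (c₂ ω p q + c₂ ω q j)      ≤⟨ ∸-monoʳ-≤ y (c₂-triangle j p<q vp<vq) ⟩
      y ∸ c₂ ω p j                   ∎
    where open ≤-Reasoning

  ≼⇒⊑ : ∀ {q x p y} → 0 < x → m (q , x) ≼ m (p , y) → (q , x) ⊑ (p , y)
  ≼⇒⊑ {q} {x} {p} {y} 0<x m≼m with position p q | subst (_≤ mvec ω p y q) (mvec-at q x) (m≼m q)
  ... | before q<p | x≤ = ⊥-elim (<⇒≱ 0<x (subst (x ≤_) (mvec-before y q<p) x≤))
  ... | at | x≤ = same-row (subst (x ≤_) (mvec-at p y) x≤)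
  ... | inverted p<q vq<vp | x≤ = ⊥-elim (<⇒≱ 0<x (subst (x ≤_) (mvec-inverted y p<q vq<vp) x≤))
  ... | ascent p<q vp<vq | x≤ =
    earlier-row p<q vp<vq (0<m≤o∸n⇒m+n≤o 0<x (subst (x ≤_) (mvec-ascent y p<q vp<vq) x≤))

  Contains34xy : Set
  Contains34xy = ∃[ p ] ∃[ r ] (toℕ p < toℕ r × val ω p < val ω r × 2 ≤ #below-after r p)

  tall-earlier-row⇒34xy : ∀ {p s w y} → toℕ p < toℕ s → val ω p < val ω s →
    w + c₂ ω p s ≤ y → y ≤ c ω p → 2 ≤ w → Contains34xy
  tall-earlier-row⇒34xy {p} {s} {w} {y} p<s vp<vs w+c≤y y≤c 2≤w =
    p , s , p<s , vp<vs , ≤-trans 2≤w (+-cancelˡ-≤ (c₂ ω p s) w _ c+w≤c+#)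
    where
    open ≤-Reasoning
    c+w≤c+# : c₂ ω p s + w ≤ c₂ ω p s + #below-after s p
    c+w≤c+# = begin
      c₂ ω p s + w                ≡⟨ +-comm (c₂ ω p s) w ⟩
      w + c₂ ω p s                ≤⟨ w+c≤y ⟩
      y                           ≤⟨ y≤c ⟩
      c ω p                       ≡⟨ c≡c₂+#below-after p<s vp<vs ⟩
      c₂ ω p s + #below-after s p ∎

  -- r < s, ω r < ω s: unless w ≥ 2, the element (s , w) would lie below (r , u).
  ascending-rows⇒34xy : ∀ {q x r u s w p y} → 0 < x → y ≤ c ω p →
    toℕ r < toℕ s → val ω r < val ω s → toℕ s ≤ toℕ q → x + c₂ ω r q ≤ u →
    (r , u) ⊑ (p , y) → (s , w) ⊑ (p , y) → ¬ (s , w) ⊑ (r , u) → Contains34xy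
  ascending-rows⇒34xy _ _ r<s _ _ _ b⊑d (same-row _) _ = ⊥-elim (<⇒≱ r<s (⊑-position b⊑d))
  ascending-rows⇒34xy {q} {x} {r} {u} {s} {w} 0<x y≤c r<s vr<vs s≤q x+c≤u _
    (earlier-row p<s vp<vs w+c≤y) e⋢b with 2 ≤? w
  ... | yes 2≤w = tall-earlier-row⇒34xy p<s vp<vs w+c≤y y≤c 2≤w
  ... | no  2≰w = ⊥-elim (e⋢b (earlier-row r<s vr<vs w+c≤u))
    where
    w+c≤u : w + c₂ ω r s ≤ u
    w+c≤u = ≤-trans (+-mono-≤ (≤-trans (s≤s⁻¹ (≰⇒> 2≰w)) 0<x) (c₂-monoʳ-≤ r s≤q)) x+c≤u

  -- r < s, ω s < ω r: s is counted by c₂ ω r q, which forces u ≥ 2.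
  descending-rows⇒34xy : ∀ {q x r u s w p y} → 0 < x → y ≤ c ω p →
    toℕ r < toℕ s → val ω s < val ω r → val ω r < val ω q → x + c₂ ω r q ≤ u →
    (q , x) ⊑ (s , w) → (r , u) ⊑ (p , y) → (s , w) ⊑ (p , y) → Contains34xy
  descending-rows⇒34xy _ _ _ vs<vr vr<vq _ (same-row _) _ _ = ⊥-elim (<-asym vs<vr vr<vq)
  descending-rows⇒34xy _ _ r<s _ _ _ _ (same-row _) (same-row _) = ⊥-elim (<-irrefl refl r<s)
  descending-rows⇒34xy _ _ _ vs<vr _ _ _ (same-row _) (earlier-row _ vr<vs _) =
    ⊥-elim (<-asym vs<vr vr<vs)
  descending-rows⇒34xy {q} {r = r} {s = s} 0<x y≤c r<s vs<vr _ x+c≤u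
    (earlier-row s<q _ _) (earlier-row p<r vp<vr u+c≤y) _ =
    tall-earlier-row⇒34xy p<r vp<vr u+c≤y y≤c (≤-trans (+-mono-≤ 0<x 1≤c₂) x+c≤u)
    where
    1≤c₂ : 1 ≤ c₂ ω r q
    1≤c₂ = witness⇒count-pos {p = below-between r q} {s} (below-between⁺ r<s s<q vs<vr)

  B₂-rows-ordered⇒34xy : ∀ {q x r u s w p y} → 0 < x → y ≤ c ω p → toℕ r < toℕ s →
    (q , x) ⊑ (r , u) → (q , x) ⊑ (s , w) → (r , u) ⊑ (p , y) → (s , w) ⊑ (p , y) →
    ¬ (s , w) ⊑ (r , u) → Contains34xy
  B₂-rows-ordered⇒34xy _ _ r<s (same-row _) a⊑e _ _ _ = ⊥-elim (<⇒≱ r<s (⊑-position a⊑e))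
  B₂-rows-ordered⇒34xy {r = r} {s = s} 0<x y≤c r<s (earlier-row _ vr<vq x+c≤u) a⊑e b⊑d e⊑d e⋢b
    with <-cmp (val ω r) (val ω s)
  ... | tri< vr<vs _ _ =
    ascending-rows⇒34xy 0<x y≤c r<s vr<vs (⊑-position a⊑e) x+c≤u b⊑d e⊑d e⋢b
  ... | tri≈ _ vr≡vs _ = ⊥-elim (<-irrefl (cong toℕ (val-injective vr≡vs)) r<s)
  ... | tri> _ _ vs<vr = descending-rows⇒34xy 0<x y≤c r<s vs<vr vr<vq x+c≤u a⊑e b⊑d e⊑d

  B₂-labels⇒34xy : ∀ {q x r u s w p y} → 0 < x → y ≤ c ω p →
    (q , x) ⊑ (r , u) → (q , x) ⊑ (s , w) → (r , u) ⊑ (p , y) → (s , w) ⊑ (p , y) →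
    ¬ (r , u) ⊑ (s , w) → ¬ (s , w) ⊑ (r , u) → Contains34xy
  B₂-labels⇒34xy {r = r} {u} {s} {w} 0<x y≤c a⊑b a⊑e b⊑d e⊑d b⋢e e⋢b with <-cmp (toℕ r) (toℕ s)
  ... | tri< r<s _ _ = B₂-rows-ordered⇒34xy 0<x y≤c r<s a⊑b a⊑e b⊑d e⊑d e⋢b
  ... | tri> _ _ s<r = B₂-rows-ordered⇒34xy 0<x y≤c s<r a⊑e a⊑b e⊑d b⊑d b⋢e
  ... | tri≈ _ r≡s _ with toℕ-injective r≡s | ≤-total u w
  ...   | refl | inj₁ u≤w = ⊥-elim (b⋢e (same-row u≤w))
  ...   | refl | inj₂ w≤u = ⊥-elim (e⋢b (same-row w≤u))

  HasB₂⇒34xy : HasB₂ ω → Contains34xy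
  HasB₂⇒34xy (_ , _ , _ , _ ,
              (q , x , 0<x , _ , a≐) , (r , u , 0<u , _ , b≐) ,
              (s , w , 0<w , _ , e≐) , (p , y , _ , y≤c , d≐) ,
              _ , _ , _ , _ , _ , _ , a≼b , a≼e , b≼d , e≼d , b⋠e , e⋠b) =
    B₂-labels⇒34xy 0<x y≤c
      (lift (q , x) (r , u) 0<x a≐ b≐ a≼b) (lift (q , x) (s , w) 0<x a≐ e≐ a≼e)
      (lift (r , u) (p , y) 0<u b≐ d≐ b≼d) (lift (s , w) (p , y) 0<w e≐ d≐ e≼d)
      (λ b⊑e → b⋠e (≼-resp-≐ (≐-sym b≐) (≐-sym e≐) (⊑⇒≼ b⊑e)))
      (λ e⊑b → e⋠b (≼-resp-≐ (≐-sym e≐) (≐-sym b≐) (⊑⇒≼ e⊑b)))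
    where
    lift : ∀ {v v′} a b → 0 < proj₂ a → v ≐ m a → v′ ≐ m b → v ≼ v′ → a ⊑ b
    lift _ _ 0<x v≐ v′≐ v≼v′ = ≼⇒⊑ 0<x (≼-resp-≐ v≐ v′≐ v≼v′)

  label∈M : ∀ a → 0 < proj₂ a → proj₂ a ≤ c ω (proj₁ a) → InM ω (m a)
  label∈M (i , x) 0<x x≤c = i , x , 0<x , x≤c , λ _ → refl

  -- The six distinctness conditions follow from the incomparability of b and e.
  HasB₂-intro : ∀ {a b e d} → InM ω a → InM ω b → InM ω e → InM ω d →
    a ≼ b → a ≼ e → b ≼ d → e ≼ d → ¬ b ≼ e → ¬ e ≼ b → HasB₂ ω
  HasB₂-intro a∈ b∈ e∈ d∈ a≼b a≼e b≼d e≼d b⋠e e⋠b =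
    _ , _ , _ , _ , a∈ , b∈ , e∈ , d∈ ,
    (λ a≐b → b⋠e (≼-trans (≐⇒≼ (≐-sym a≐b)) a≼e)) ,
    (λ a≐e → e⋠b (≼-trans (≐⇒≼ (≐-sym a≐e)) a≼b)) ,
    (λ a≐d → b⋠e (≼-trans b≼d (≼-trans (≐⇒≼ (≐-sym a≐d)) a≼e))) ,
    (λ b≐e → b⋠e (≐⇒≼ b≐e)) ,
    (λ b≐d → e⋠b (≼-trans e≼d (≐⇒≼ (≐-sym b≐d)))) ,
    (λ e≐d → b⋠e (≼-trans b≼d (≐⇒≼ (≐-sym e≐d)))) ,
    a≼b , a≼e , b≼d , e≼d , b⋠e , e⋠b

  34xy⇒HasB₂ : Contains34xy → HasB₂ ω
  34xy⇒HasB₂ (p , r , p<r , vp<vr , 2≤#) =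
    HasB₂-intro
      (label∈M a z<s (≤-trans (n≤1+n 1) 2≤c[r])) (label∈M b z<s (≤-trans (n≤1+n _) 2+c₂≤c[p]))
      (label∈M e z<s 2≤c[r]) (label∈M d z<s 2+c₂≤c[p])
      (⊑⇒≼ a⊑b) (⊑⇒≼ a⊑e) (⊑⇒≼ b⊑d) (⊑⇒≼ e⊑d)
      (λ b≼e → <⇒≱ p<r (⊑-position (≼⇒⊑ {p} z<s b≼e)))
      (λ e≼b → e⋢b (≼⇒⊑ {r} z<s e≼b))
    where
    a b e d : Label
    a = r , 1
    b = p , 1 + c₂ ω p r
    e = r , 2
    d = p , 2 + c₂ ω p r
    a⊑b : a ⊑ b
    a⊑b = earlier-row p<r vp<vr ≤-refl
    a⊑e : a ⊑ e
    a⊑e = same-row (n≤1+n 1)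
    b⊑d : b ⊑ d
    b⊑d = same-row (n≤1+n _)
    e⊑d : e ⊑ d
    e⊑d = earlier-row p<r vp<vr ≤-refl
    e⋢b : ¬ e ⊑ b
    e⋢b (same-row _)              = <-irrefl refl p<r
    e⋢b (earlier-row _ _ 2+c≤1+c) = <-irrefl refl 2+c≤1+c
    2≤c[r] : 2 ≤ c ω r
    2≤c[r] = ≤-trans 2≤# (count-mono widen)
      where
      widen : T ∘ below-after r p ⊆′ T ∘ below-after r r
      widen k t with below-after⁻ {r} {p} {k} t
      ... | r<k , vk<vp = below-after⁺ r<k (<-trans vk<vp vp<vr)
    2+c₂≤c[p] : 2 + c₂ ω p r ≤ c ω p
    2+c₂≤c[p] = begin
      2 + c₂ ω p r                ≡⟨ +-comm 2 (c₂ ω p r) ⟩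
      c₂ ω p r + 2                ≤⟨ +-monoʳ-≤ (c₂ ω p r) 2≤# ⟩
      c₂ ω p r + #below-after r p ≡⟨ sym (c≡c₂+#below-after p<r vp<vr) ⟩
      c ω p                       ∎
      where open ≤-Reasoning

  contains-ranked : ∀ {k} {pat : Fin k → ℕ} (R : Ranking pat) (f : Fin k → Fin n) →
    Ascending (toℕ ∘ f) → Ascending (val ω ∘ f ∘ Ranking.unrank R) → Contains ω pat
  contains-ranked R f positions values =
    f , (λ _ _ → ascending⇒strictlyIncreasing positions) ,
    rank-order R (val ω ∘ f) (ascending⇒strictlyIncreasing values)

  34xy⇒3412⊎3421 : Contains34xy → Contains ω pat3412 ⊎ Contains ω pat3421
  34xy⇒3412⊎3421 (p , r , p<r , vp<vr , 2≤#) with count≥2⇒two-witnesses 2≤#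
  ... | j , k , j<k , tj , tk with below-after⁻ tj | below-after⁻ tk | <-cmp (val ω j) (val ω k)
  ... | r<j , vj<vp | _ , vk<vp | tri< vj<vk _ _ =
    inj₁ (contains-ranked ranking3412 (lookup (p ∷ r ∷ j ∷ k ∷ []))
            (p<r , r<j , j<k , tt) (vj<vk , vk<vp , vp<vr , tt))
  ... | _ | _ | tri≈ _ vj≡vk _ = ⊥-elim (<-irrefl (cong toℕ (val-injective vj≡vk)) j<k)
  ... | r<j , vj<vp | _ , vk<vp | tri> _ _ vk<vj =
    inj₂ (contains-ranked ranking3421 (lookup (p ∷ r ∷ j ∷ k ∷ []))
            (p<r , r<j , j<k , tt) (vk<vj , vj<vp , vp<vr , tt))

  34xy-pattern⇒34xy : ∀ {pat : Fin 4 → ℕ} → pat (# 0) < pat (# 1) → pat (# 2) < pat (# 0) →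
    pat (# 3) < pat (# 0) → Contains ω pat → Contains34xy
  34xy-pattern⇒34xy {pat} p₀<p₁ p₂<p₀ p₃<p₀ (f , f-mono , f-iso) =
    f (# 0) , f (# 1) , f-mono (# 0) (# 1) z<s , order (# 0) (# 1) p₀<p₁ ,
    two-witnesses⇒count≥2 {p = below-after (f (# 1)) (f (# 0))}
      (f-mono (# 2) (# 3) (s<s (s<s z<s)))
      (below-after⁺ (f-mono (# 1) (# 2) (s<s z<s)) (order (# 2) (# 0) p₂<p₀))
      (below-after⁺ (f-mono (# 1) (# 3) (s<s z<s)) (order (# 3) (# 0) p₃<p₀))
    where
    order : ∀ a b → pat a < pat b → val ω (f a) < val ω (f b)
    order a b = Equivalence.from (f-iso a b)

mainTheorem1 : (n : ℕ) → 1 ≤ n → (ω : Permutation′ n) →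
    B₂-free ω ⇔ (Avoids ω pat3412 × Avoids ω pat3421)
mainTheorem1 n _ ω = mk⇔
  (λ free → (free ∘ 34xy⇒HasB₂ ω ∘ 34xy-pattern⇒34xy ω (n<1+n 3) (s<s z<s) (n<1+n 2))
          , (free ∘ 34xy⇒HasB₂ ω ∘ 34xy-pattern⇒34xy ω (n<1+n 3) (n<1+n 2) (s<s z<s)))
  (λ (avoids3412 , avoids3421) → [ avoids3412 , avoids3421 ] ∘ 34xy⇒3412⊎3421 ω ∘ HasB₂⇒34xy ω)
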